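{- For positive integers $n$ and $k$ with $n\geq k$, $\log\log(d_n+1)\leq n+\log\log(d_k+1)-k$.
   Context: All logarithms are to base two. A delta-matroid $(E,\mathcal F)$ consists of a finite set $E$ and a non-empty collection $\mathcal F$ of subsets of $E$ satisfying: for all $X,Y\in\mathcal F$ and every $e\in X\bigtriangleup Y$ there exists $f\in X\bigtriangleup Y$ (possibly $f=e$) with $X\bigtriangleup\{e,f\}\in\mathcal F$. Let $d_n$ denote the number of delta-matroids with ground set $[n]=\{1,\dots,n\}$. -}

module Defs where

open import Data.Nat using (ℕ; zero; suc)
open import Data.Bool using (true; false)
open import Data.Vec using ([]; _∷_)
import Data.Vec.Properties as VecP
import Data.Bool.Properties as BoolP
open import Data.List using (List; []; _∷_; [_]; _++_; map; filter; length)
open import Data.List.Relation.Unary.All as All using (All)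
open import Data.Fin using (Fin)
open import Data.Fin.Subset using (Subset; ⁅_⁆; _∪_; _─_)
  renaming (_∈_ to _∈ₛ_)
open import Data.Fin.Subset.Properties using () renaming (_∈?_ to _∈ₛ?_)
open import Data.Fin.Properties using (any?; all?)
open import Data.Product using (∃; _×_)
open import Relation.Binary.PropositionalEquality using (_≡_; _≢_; refl)
open import Relation.Nullary using (Dec; yes; no; ¬_)
open import Relation.Nullary.Decidable using (_×-dec_; _→-dec_)
open import Relation.Unary using (Decidable)
import Data.List.Membership.DecPropositional as DecMem

_△_ : ∀ {n} → Subset n → Subset n → Subset n
X △ Y = (X ─ Y) ∪ (Y ─ X)

infixl 5 _△_

module _ {n : ℕ} where
  open DecMem {A = Subset n} (VecP.≡-dec BoolP._≟_) public
    using (_∈_; _∈?_)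

SymExchange : ∀ {n} → List (Subset n) → Subset n → Subset n → Set
SymExchange F X Y =
  ∀ e → e ∈ₛ (X △ Y) →
    ∃ λ f → f ∈ₛ (X △ Y) × (X △ (⁅ e ⁆ ∪ ⁅ f ⁆)) ∈ F

IsDeltaMatroid : ∀ {n} → List (Subset n) → Set
IsDeltaMatroid F =
  F ≢ [] × All (λ X → All (λ Y → SymExchange F X Y) F) F

nonEmpty? : ∀ {A : Set} (xs : List A) → Dec (xs ≢ [])
nonEmpty? []       = no (λ ne → ne refl)
nonEmpty? (_ ∷ _)  = yes (λ ())

symExchange? : ∀ {n} (F : List (Subset n)) X Y → Dec (SymExchange F X Y)
symExchange? F X Y =
  all? (λ e → (e ∈ₛ? (X △ Y)) →-dec
     any? (λ f → (f ∈ₛ? (X △ Y)) ×-dec ((X △ (⁅ e ⁆ ∪ ⁅ f ⁆)) ∈? F)))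

isDeltaMatroid? : ∀ {n} → Decidable (IsDeltaMatroid {n})
isDeltaMatroid? F =
  nonEmpty? F ×-dec All.all? (λ X → All.all? (λ Y → symExchange? F X Y) F) F

-- All subsets of Fin n (each exactly once).
allSubsets : ∀ n → List (Subset n)
allSubsets zero    = [ [] ]
allSubsets (suc n) = map (true ∷_) (allSubsets n) ++ map (false ∷_) (allSubsets n)

-- All sublists of a list (2^length many; distinct sublists of a
-- duplicate-free list represent distinct sets).
sublists : ∀ {A : Set} → List A → List (List A)
sublists []       = [ [] ]
sublists (x ∷ xs) = map (x ∷_) (sublists xs) ++ sublists xs

d : ℕ → ℕ
d n = length (filter isDeltaMatroid? (sublists (allSubsets n)))

-- Split a family of subsets of [n + 1] by whether its members contain the first element:
-- the members containing it give a family L₁ on [n], the others a family L₀. If the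
-- family is a delta-matroid then so are L₁ and L₀ unless they are empty, because an
-- exchange between two members on the same side never involves the first element.
-- Hence d n + 1, the number of families that are empty or a delta-matroid, satisfies
-- d (n + 1) + 1 ≤ (d n + 1)², and iterating n ∸ k times gives the bound.
module Submission where

open import Defs
open import Data.Nat using (ℕ; zero; suc; _+_; _*_; _^_; _∸_; _≤_; z≤n; s≤s; NonZero)
open import Data.Nat.Properties
open import Data.Bool using (true; false)
open import Data.Vec using (_∷_)
open import Data.Vec.Base using (there)
open import Data.List using (List; []; _∷_; _++_; map; filter; length; cartesianProductWith)
open import Data.List.Properties
  using (map-++; map-∘; map-id; ++-identityʳ; length-++; filter-++; filter-none; cartesianProductWith-distribʳ-++)
open import Data.List.Relation.Unary.All as All using (All)
open import Data.List.Relation.Unary.All.Properties as All using ()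
open import Data.List.Relation.Unary.Any using (here)
open import Data.List.Membership.Propositional.Properties using (∈-map⁺; ∈-map⁻; ∈-++⁺ˡ; ∈-++⁺ʳ; ∈-++⁻)
open import Data.Fin using () renaming (zero to fz; suc to fs)
open import Data.Fin.Subset using (Subset) renaming (_∈_ to _∈ₛ_)
open import Data.Product using (_×_; _,_; proj₁; proj₂)
open import Data.Sum using (_⊎_; inj₁; inj₂)
open import Function.Bundles using (_⇔_; mk⇔; Equivalence)
open Equivalence using (to; from)
open import Level using (Level)
open import Relation.Binary.PropositionalEquality
open import Relation.Nullary using (Dec; yes; no; ¬_; contradiction)
open import Relation.Unary using (Pred; Decidable)
open import Relation.Unary.Properties using (_∪?_)

private variable
  a p q r : Level
  A A′ B B′ C D : Set a

count : {P : Pred A p} → Decidable P → List A → ℕ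
count P? xs = length (filter P? xs)

module _ {P : Pred A p} (P? : Decidable P) where

  count-++ : ∀ xs ys → count P? (xs ++ ys) ≡ count P? xs + count P? ys
  count-++ xs ys = trans (cong length (filter-++ P? xs ys)) (length-++ (filter P? xs))

  count-map-none : (g : B → A) → (∀ y → ¬ P (g y)) → ∀ ys → count P? (map g ys) ≡ 0
  count-map-none g ¬P ys = cong length (filter-none P? (All.map⁺ (All.universal ¬P ys)))

  count-map-≤ : {R : Pred B r} (R? : Decidable R) (g : B → A) →
    (∀ {y} → P (g y) → R y) → ∀ ys → count P? (map g ys) ≤ count R? ys
  count-map-≤ R? g P⇒R [] = z≤n
  count-map-≤ R? g P⇒R (y ∷ ys) with P? (g y) | R? y
  ... | yes Pgy | yes _  = s≤s (count-map-≤ R? g P⇒R ys)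
  ... | yes Pgy | no ¬Ry = contradiction (P⇒R Pgy) ¬Ry
  ... | no _    | yes _  = m≤n⇒m≤1+n (count-map-≤ R? g P⇒R ys)
  ... | no _    | no _   = count-map-≤ R? g P⇒R ys

  count-⊎ : {Q : Pred A q} (Q? : Decidable Q) → (∀ {x} → P x → ¬ Q x) →
    ∀ xs → count (P? ∪? Q?) xs ≡ count P? xs + count Q? xs
  count-⊎ Q? P⇒¬Q [] = refl
  count-⊎ Q? P⇒¬Q (x ∷ xs) with P? x | Q? x
  ... | yes Px | yes Qx = contradiction Qx (P⇒¬Q Px)
  ... | yes _  | no _   = cong suc (count-⊎ Q? P⇒¬Q xs)
  ... | no _   | yes _  = trans (cong suc (count-⊎ Q? P⇒¬Q xs)) (sym (+-suc _ _))
  ... | no _   | no _   = count-⊎ Q? P⇒¬Q xs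

count-cartesianProductWith-≤ :
  {P : Pred C p} {Q : Pred A q} {R : Pred B r}
  (P? : Decidable P) (Q? : Decidable Q) (R? : Decidable R) (f : A → B → C) →
  (∀ {x y} → P (f x y) → Q x × R y) → ∀ xs ys →
  count P? (cartesianProductWith f xs ys) ≤ count Q? xs * count R? ys
count-cartesianProductWith-≤ P? Q? R? f split [] ys = z≤n
count-cartesianProductWith-≤ P? Q? R? f split (x ∷ xs) ys
  rewrite count-++ P? (map (f x) ys) (cartesianProductWith f xs ys)
  with Q? x
... | yes _  = +-mono-≤ (count-map-≤ P? R? (f x) (λ Pfxy → proj₂ (split Pfxy)) ys)
                        (count-cartesianProductWith-≤ P? Q? R? f split xs ys)
... | no ¬Qx = +-mono-≤ (≤-reflexive (count-map-none P? (f x) (λ _ Pfxy → ¬Qx (proj₁ (split Pfxy))) ys))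
                        (count-cartesianProductWith-≤ P? Q? R? f split xs ys)

module _ (f : A → B → C) where

  cartesianProductWith-mapˡ : (g : A′ → A) → ∀ xs ys →
    cartesianProductWith f (map g xs) ys ≡ cartesianProductWith (λ x y → f (g x) y) xs ys
  cartesianProductWith-mapˡ g []       ys = refl
  cartesianProductWith-mapˡ g (x ∷ xs) ys =
    cong (map (f (g x)) ys ++_) (cartesianProductWith-mapˡ g xs ys)

  cartesianProductWith-mapʳ : (h : B′ → B) → ∀ xs ys →
    cartesianProductWith f xs (map h ys) ≡ cartesianProductWith (λ x y → f x (h y)) xs ys
  cartesianProductWith-mapʳ h []       ys = refl
  cartesianProductWith-mapʳ h (x ∷ xs) ys =
    cong₂ _++_ (sym (map-∘ ys)) (cartesianProductWith-mapʳ h xs ys)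

map-cartesianProductWith : (h : C → D) (f : A → B → C) → ∀ xs ys →
  map h (cartesianProductWith f xs ys) ≡ cartesianProductWith (λ x y → h (f x y)) xs ys
map-cartesianProductWith h f []       ys = refl
map-cartesianProductWith h f (x ∷ xs) ys = begin
  map h (map (f x) ys ++ cartesianProductWith f xs ys)
    ≡⟨ map-++ h (map (f x) ys) _ ⟩
  map h (map (f x) ys) ++ map h (cartesianProductWith f xs ys)
    ≡⟨ cong₂ _++_ (sym (map-∘ ys)) (map-cartesianProductWith h f xs ys) ⟩
  map (λ y → h (f x y)) ys ++ cartesianProductWith (λ x y → h (f x y)) xs ys ∎
  where open ≡-Reasoning

sublists-map : (g : A → B) (xs : List A) → sublists (map g xs) ≡ map (map g) (sublists xs)
sublists-map g []       = refl
sublists-map g (x ∷ xs) = begin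
  map (g x ∷_) (sublists (map g xs)) ++ sublists (map g xs)
    ≡⟨ cong (λ S → map (g x ∷_) S ++ S) (sublists-map g xs) ⟩
  map (g x ∷_) (map (map g) S) ++ map (map g) S
    ≡⟨ cong (_++ map (map g) S) (trans (sym (map-∘ S)) (map-∘ S)) ⟩
  map (map g) (map (x ∷_) S) ++ map (map g) S
    ≡⟨ map-++ (map g) (map (x ∷_) S) S ⟨
  map (map g) (map (x ∷_) S ++ S) ∎
  where open ≡-Reasoning
        S = sublists xs

sublists-++ : (xs ys : List A) →
  sublists (xs ++ ys) ≡ cartesianProductWith _++_ (sublists xs) (sublists ys)
sublists-++ []       ys = sym (trans (++-identityʳ _) (map-id (sublists ys)))
sublists-++ (x ∷ xs) ys = begin
  map (x ∷_) (sublists (xs ++ ys)) ++ sublists (xs ++ ys)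
    ≡⟨ cong (λ S → map (x ∷_) S ++ S) (sublists-++ xs ys) ⟩
  map (x ∷_) (cartesianProductWith _++_ Sx Sy) ++ cartesianProductWith _++_ Sx Sy
    ≡⟨ cong (_++ cartesianProductWith _++_ Sx Sy)
         (trans (map-cartesianProductWith (x ∷_) _++_ Sx Sy)
                (sym (cartesianProductWith-mapˡ _++_ (x ∷_) Sx Sy))) ⟩
  cartesianProductWith _++_ (map (x ∷_) Sx) Sy ++ cartesianProductWith _++_ Sx Sy
    ≡⟨ cartesianProductWith-distribʳ-++ _++_ (map (x ∷_) Sx) Sx Sy ⟨
  cartesianProductWith _++_ (map (x ∷_) Sx ++ Sx) Sy ∎
  where open ≡-Reasoning
        Sx = sublists xs
        Sy = sublists ys

DeltaMatroidOrEmpty : ∀ {n} → List (Subset n) → Set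
DeltaMatroidOrEmpty F = IsDeltaMatroid F ⊎ F ≡ []

isEmpty? : (xs : List A) → Dec (xs ≡ [])
isEmpty? []      = yes refl
isEmpty? (_ ∷ _) = no λ ()

deltaMatroidOrEmpty? : ∀ {n} → Decidable (DeltaMatroidOrEmpty {n})
deltaMatroidOrEmpty? = isDeltaMatroid? ∪? isEmpty?

module _ {n : ℕ} where

  fz∉△-cons : ∀ b (X Y : Subset n) → ¬ fz ∈ₛ (b ∷ X) △ (b ∷ Y)
  fz∉△-cons true  X Y ()
  fz∉△-cons false X Y ()

  △-cons-false : ∀ b (X Z : Subset n) → (b ∷ X) △ (false ∷ Z) ≡ b ∷ (X △ Z)
  △-cons-false true  X Z = refl
  △-cons-false false X Z = refl

  exchange-restrict : ∀ b {M : List (Subset (suc n))} {L : List (Subset n)} →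
    (∀ {Z} → Z ∈ L ⇔ (b ∷ Z) ∈ M) →
    All (λ X → All (λ Y → SymExchange M X Y) M) M →
    All (λ X → All (λ Y → SymExchange L X Y) L) L
  exchange-restrict b {M} {L} L⇔M exM =
    All.tabulate λ {X} X∈L → All.tabulate λ {Y} Y∈L → exchange X Y X∈L Y∈L
    where
    exchange : ∀ X Y → X ∈ L → Y ∈ L → SymExchange L X Y
    exchange X Y X∈L Y∈L e e∈
      with All.lookup (All.lookup exM (to L⇔M X∈L)) (to L⇔M Y∈L) (fs e) (there e∈)
    ... | fz   , f∈       , _ = contradiction f∈ (fz∉△-cons b X Y)
    ... | fs f , there f∈ , X△ef∈M =
      f , f∈ , from L⇔M (subst (_∈ M) (△-cons-false b X _) X△ef∈M)

  deltaMatroidOrEmpty-restrict : ∀ b {M : List (Subset (suc n))} {L : List (Subset n)} →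
    (∀ {Z} → Z ∈ L ⇔ (b ∷ Z) ∈ M) → DeltaMatroidOrEmpty M → DeltaMatroidOrEmpty L
  deltaMatroidOrEmpty-restrict b {L = []}    L⇔M _                = inj₂ refl
  deltaMatroidOrEmpty-restrict b {L = _ ∷ _} L⇔M (inj₁ (_ , exM)) =
    inj₁ ((λ ()) , exchange-restrict b L⇔M exM)
  deltaMatroidOrEmpty-restrict b {L = _ ∷ _} L⇔M (inj₂ refl) with () ← to L⇔M (here refl)

glue : ∀ {n} → List (Subset n) → List (Subset n) → List (Subset (suc n))
glue L₁ L₀ = map (true ∷_) L₁ ++ map (false ∷_) L₀

∷-∈-map-∷⁻ : ∀ {n b c} {Z : Subset n} {L} → (b ∷ Z) ∈ map (c ∷_) L → b ≡ c × Z ∈ L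
∷-∈-map-∷⁻ m with ∈-map⁻ _ m
... | _ , Z∈L , refl = refl , Z∈L

module _ {n : ℕ} {L₁ L₀ : List (Subset n)} where

  ∈-glue-true : ∀ {Z} → Z ∈ L₁ ⇔ (true ∷ Z) ∈ glue L₁ L₀
  ∈-glue-true = mk⇔ (λ Z∈ → ∈-++⁺ˡ (∈-map⁺ _ Z∈)) from-glue
    where
    from-glue : ∀ {Z} → (true ∷ Z) ∈ glue L₁ L₀ → Z ∈ L₁
    from-glue m with ∈-++⁻ (map (true ∷_) L₁) m
    ... | inj₁ m₁ = proj₂ (∷-∈-map-∷⁻ m₁)
    ... | inj₂ m₀ with () ← proj₁ (∷-∈-map-∷⁻ m₀)

  ∈-glue-false : ∀ {Z} → Z ∈ L₀ ⇔ (false ∷ Z) ∈ glue L₁ L₀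
  ∈-glue-false = mk⇔ (λ Z∈ → ∈-++⁺ʳ (map (true ∷_) L₁) (∈-map⁺ _ Z∈)) from-glue
    where
    from-glue : ∀ {Z} → (false ∷ Z) ∈ glue L₁ L₀ → Z ∈ L₀
    from-glue m with ∈-++⁻ (map (true ∷_) L₁) m
    ... | inj₁ m₁ with () ← proj₁ (∷-∈-map-∷⁻ m₁)
    ... | inj₂ m₀ = proj₂ (∷-∈-map-∷⁻ m₀)

  deltaMatroidOrEmpty-glue⁻ : DeltaMatroidOrEmpty (glue L₁ L₀) →
    DeltaMatroidOrEmpty L₁ × DeltaMatroidOrEmpty L₀
  deltaMatroidOrEmpty-glue⁻ M =
    deltaMatroidOrEmpty-restrict true ∈-glue-true M ,
    deltaMatroidOrEmpty-restrict false ∈-glue-false M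

sublists-allSubsets-suc : ∀ n → sublists (allSubsets (suc n)) ≡
  cartesianProductWith glue (sublists (allSubsets n)) (sublists (allSubsets n))
sublists-allSubsets-suc n = begin
  sublists (map (true ∷_) U ++ map (false ∷_) U)
    ≡⟨ sublists-++ (map (true ∷_) U) (map (false ∷_) U) ⟩
  cartesianProductWith _++_ (sublists (map (true ∷_) U)) (sublists (map (false ∷_) U))
    ≡⟨ cong₂ (cartesianProductWith _++_) (sublists-map (true ∷_) U) (sublists-map (false ∷_) U) ⟩
  cartesianProductWith _++_ (map (map (true ∷_)) S) (map (map (false ∷_)) S)
    ≡⟨ cartesianProductWith-mapˡ _++_ (map (true ∷_)) S _ ⟩
  cartesianProductWith (λ L₁ → map (true ∷_) L₁ ++_) S (map (map (false ∷_)) S)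
    ≡⟨ cartesianProductWith-mapʳ _ (map (false ∷_)) S S ⟩
  cartesianProductWith glue S S ∎
  where open ≡-Reasoning
        U = allSubsets n
        S = sublists U

d⁺ : ℕ → ℕ
d⁺ n = count deltaMatroidOrEmpty? (sublists (allSubsets n))

count-isEmpty-sublists : (xs : List A) → count isEmpty? (sublists xs) ≡ 1
count-isEmpty-sublists []       = refl
count-isEmpty-sublists (x ∷ xs) = begin
  count isEmpty? (map (x ∷_) S ++ S)           ≡⟨ count-++ isEmpty? (map (x ∷_) S) S ⟩
  count isEmpty? (map (x ∷_) S) + count isEmpty? S
    ≡⟨ cong₂ _+_ (count-map-none isEmpty? (x ∷_) (λ _ ()) S) (count-isEmpty-sublists xs) ⟩
  1 ∎
  where open ≡-Reasoning
        S = sublists xs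

d⁺≡d+1 : ∀ n → d⁺ n ≡ d n + 1
d⁺≡d+1 n = trans (count-⊎ isDeltaMatroid? isEmpty? (λ (nonEmpty , _) → nonEmpty) S)
                 (cong (d n +_) (count-isEmpty-sublists (allSubsets n)))
  where S = sublists (allSubsets n)

d⁺-suc : ∀ n → d⁺ (suc n) ≤ d⁺ n * d⁺ n
d⁺-suc n rewrite sublists-allSubsets-suc n =
  count-cartesianProductWith-≤ deltaMatroidOrEmpty? deltaMatroidOrEmpty? deltaMatroidOrEmpty?
    glue deltaMatroidOrEmpty-glue⁻ S S
  where S = sublists (allSubsets n)

d⁺-+ : ∀ k m → d⁺ (k + m) ≤ d⁺ k ^ 2 ^ m
d⁺-+ k zero = ≤-reflexive (trans (cong d⁺ (+-identityʳ k)) (sym (*-identityʳ (d⁺ k))))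
d⁺-+ k (suc m) = begin
  d⁺ (k + suc m)              ≡⟨ cong d⁺ (+-suc k m) ⟩
  d⁺ (suc (k + m))            ≤⟨ d⁺-suc (k + m) ⟩
  d⁺ (k + m) * d⁺ (k + m)     ≤⟨ *-mono-≤ (d⁺-+ k m) (d⁺-+ k m) ⟩
  d⁺ k ^ 2 ^ m * d⁺ k ^ 2 ^ m ≡⟨ ^-distribˡ-+-* (d⁺ k) (2 ^ m) (2 ^ m) ⟨
  d⁺ k ^ (2 ^ m + 2 ^ m)      ≡⟨ cong (λ t → d⁺ k ^ (2 ^ m + t)) (+-identityʳ (2 ^ m)) ⟨
  d⁺ k ^ 2 ^ suc m            ∎
  where open ≤-Reasoning

-- The bound holds for k = 0 as well.
corollary11 : (n k : ℕ) → .{{NonZero k}} → k ≤ n →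
    d n + 1 ≤ (d k + 1) ^ (2 ^ (n ∸ k))
corollary11 n k k≤n = begin
  d n + 1                   ≡⟨ d⁺≡d+1 n ⟨
  d⁺ n                      ≡⟨ cong d⁺ (m+[n∸m]≡n k≤n) ⟨
  d⁺ (k + (n ∸ k))          ≤⟨ d⁺-+ k (n ∸ k) ⟩
  d⁺ k ^ 2 ^ (n ∸ k)        ≡⟨ cong (_^ 2 ^ (n ∸ k)) (d⁺≡d+1 k) ⟩
  (d k + 1) ^ 2 ^ (n ∸ k)   ∎
  where open ≤-Reasoning
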